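{- $\mathsf{id}_3\equiv\mathsf{PHP}^3_2\equiv\mathsf{PHP}^4_2>\mathsf{PHP}^5_2$. Moreover, for every integer $n>2$, $$\mathsf{id}_{\binom{n+1}{2}}\equiv\mathsf{PHP}^{n+1}_n>\mathsf{PHP}^{n+2}_n\ge\mathsf{PHP}^{2n}_n>\mathsf{PHP}^{2n+1}_n\ge\mathsf{PHP}^{n^2}_n>\mathsf{PHP}^{n^2+1}_n.$$
   Context: A number $N\ge1$ is identified with $\{0,\dots,N-1\}$. A (finite) problem $\mathsf{P}$ consists of a nonempty finite set of instances and, for each instance $x$, a nonempty finite set $\mathsf{P}(x)$ of solutions. For finite problems, $\mathsf{P}\le\mathsf{Q}$ if there exist a map $\Phi$ sending each $\mathsf{P}$-instance $x$ to a $\mathsf{Q}$-instance and a (partial) map $\Psi$ on $\mathsf{Q}$-solutions such that $\Psi(y)\in\mathsf{P}(x)$ whenever $y\in\mathsf{Q}(\Phi(x))$. $\mathsf{P}\equiv\mathsf{Q}$ means $\mathsf{P}\le\mathsf{Q}$ and $\mathsf{Q}\le\mathsf{P}$; $\mathsf{P}>\mathsf{Q}$ means $\mathsf{Q}\le\mathsf{P}$ and $\mathsf{P}\not\le\mathsf{Q}$; $\mathsf{P}\ge\mathsf{Q}$ means $\mathsf{Q}\le\mathsf{P}$. For $m>n\ge2$, $\mathsf{PHP}^m_n$ has as instances all functions $f:m\to n$, with solutions all unordered pairs $\{i,j\}$, $i\ne j$, $f(i)=f(j)$. For $k\ge1$, $\mathsf{id}_k$ has instances $j\in\{1,\dots,k\}$,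 each instance $j$ having unique solution $j$. -}

module Defs where

open import Data.Nat using (ℕ; suc)
open import Data.Fin using (Fin; _<_)
open import Data.Product using (Σ; _×_; ∃)
open import Data.Maybe using (Maybe; just)
open import Relation.Binary.PropositionalEquality using (_≡_)
open import Relation.Nullary using (¬_)

-- A problem: a type of instances, a global type of solution codes, and
-- for each instance x the predicate "y is a solution of x".
-- (The concrete problems below are finite with nonempty solution sets
-- where required by the paper; these facts are not needed to state the claim.)
record Problem : Set₁ where
  field
    Inst     : Set
    Sol      : Set
    IsSol    : Inst → Sol → Set
open Problem public

record _≤ᵖ_ (P Q : Problem) : Set where
  field
    Φ       : Inst P → Inst Q
    Ψ       : Sol Q → Maybe (Sol P)
    correct : ∀ (x : Inst P) (y : Sol Q) → IsSol Q (Φ x) y →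
              ∃ λ (z : Sol P) → (Ψ y ≡ just z) × IsSol P x z

_≥ᵖ_ : Problem → Problem → Set
P ≥ᵖ Q = Q ≤ᵖ P

_≡ᵖ_ : Problem → Problem → Set
P ≡ᵖ Q = (P ≤ᵖ Q) × (Q ≤ᵖ P)

_>ᵖ_ : Problem → Problem → Set
P >ᵖ Q = (Q ≤ᵖ P) × ¬ (P ≤ᵖ Q)

-- PHP^m_n: instances f : m → n; solutions unordered pairs {i,j}, i ≠ j,
-- encoded canonically as (i , j) with i < j, and f i = f j.
PHP : ℕ → ℕ → Problem
PHP m n = record
  { Inst  = Fin m → Fin n
  ; Sol   = Fin m × Fin m
  ; IsSol = λ f p → (Data.Product.proj₁ p < Data.Product.proj₂ p)
                    × (f (Data.Product.proj₁ p) ≡ f (Data.Product.proj₂ p))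
  }

-- id_k: instances j ∈ {1..k} (encoded as Fin k = {0..k-1}), unique solution j.
idP : ℕ → Problem
idP k = record
  { Inst  = Fin k
  ; Sol   = Fin k
  ; IsSol = λ x y → y ≡ x
  }

-- A reduction R : P ≤ PHP^N_n is refuted by double counting. Weight the instances of P so that
-- every P-solution solves instances of total weight at most L. A pair of pigeons collides in Φ x
-- only if Ψ maps it to a solution of x, so the weighted number of collisions of the Φ x is at most
-- C(N,2)·L. On the other hand a map N → n with fibres s_c has Σ_c s_c² = 2·#collisions + N, and
-- s² ≥ (2q+1)s − q(q+1) bounds this from below for every q. Three weightings make the bounds
-- clash: the uniform one on id_{C(n+1,2)} ≤ PHP^{n+1}_n for n + 1 against n + 2 pigeons; the
-- uniform one on the 2n − 1 rounds of a round-robin tournament of 2n players, which gives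
-- id_{2n−1} ≤ PHP^{2n}_n, for 2n against 2n + 1; and for n² against n² + 1 the maps
-- u ↦ φ(row u) + col u (mod n) on the n × n grid, over all φ : n → n, together with the row map
-- weighted n^{n−1}. The equivalences use the instances of PHP^{n+1}_n with a single collision.

{-# OPTIONS --safe #-}
module Submission where

open import Defs
open import Data.Nat using (ℕ; zero; suc; _+_; _*_; _∸_; _^_; _≤_; _<_; z≤n; s≤s; z<s; NonZero)
open import Data.Nat.Combinatorics using (_C_; nC1≡n; nCk+nC[k+1]≡[n+1]C[k+1])
open import Data.Nat.DivMod using (_%_; %-distribˡ-+; %-distribˡ-*; m%n%n≡m%n; m<n⇒m%n≡m; [m+n]%n≡m%n; [m+kn]%n≡m%n; m%n<n)
open import Data.Nat.Properties
open import Data.Nat.Tactic.RingSolver using (solve-∀)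
open import Data.Fin as Fin using (Fin; zero; suc; toℕ)
import Data.Fin.Properties as Fin
open import Data.Vec using (Vec; []; _∷_; lookup; _[_]≔_)
open import Data.Vec.Properties using (lookup∘update; lookup∘update′)
open import Data.Product as Product using (_×_; _,_; proj₁; proj₂; ∃)
open import Data.Sum using (_⊎_; inj₁; inj₂; [_,_]′)
open import Data.Maybe using (Maybe; just; nothing; _>>=_)
open import Data.Maybe.Properties using (just-injective)
open import Data.Bool using (if_then_else_)
open import Function using (_∘_)
open import Algebra.Properties.CommutativeSemigroup +-commutativeSemigroup using (interchange)
open import Algebra.Properties.Semiring.Sum +-*-semiring
  using (sum; sum-syntax; ∑-comm; ∑-distrib-+; *-distribˡ-sum; *-distribʳ-sum; sum-cong-≗)
open import Relation.Nullary
open import Relation.Nullary.Decidable using (_×-dec_)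
open import Relation.Binary.Definitions using (tri<; tri≈; tri>)
open import Relation.Binary.PropositionalEquality

private
  variable
    A B : Set
    k N n : ℕ

≤ᵖ-trans : ∀ {P Q S} → P ≤ᵖ Q → Q ≤ᵖ S → P ≤ᵖ S
≤ᵖ-trans {P} {Q} {S} R₁ R₂ = record
  { Φ = R₂.Φ ∘ R₁.Φ ; Ψ = λ y → R₂.Ψ y >>= R₁.Ψ ; correct = correct }
  where
  module R₁ = _≤ᵖ_ R₁
  module R₂ = _≤ᵖ_ R₂
  correct : ∀ x y → IsSol S (R₂.Φ (R₁.Φ x)) y → ∃ λ z → (R₂.Ψ y >>= R₁.Ψ) ≡ just z × IsSol P x z
  correct x y s with R₂.correct (R₁.Φ x) y s
  ... | z , Ψ₂y≡z , s′ rewrite Ψ₂y≡z = R₁.correct x z s′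

PHP-antimonoˡ : ∀ {m m′ n} → m′ ≤ m → PHP m n ≤ᵖ PHP m′ n
PHP-antimonoˡ m′≤m = record
  { Φ = λ f → f ∘ inject
  ; Ψ = λ (a , b) → just (inject a , inject b)
  ; correct = λ f (a , b) (a<b , e) → _ , refl , inject-< a<b , e
  }
  where
  inject : Fin _ → Fin _
  inject i = Fin.inject≤ i m′≤m
  inject-< : ∀ {a b} → a Fin.< b → inject a Fin.< inject b
  inject-< {a} {b} = subst₂ _<_ (sym (Fin.toℕ-inject≤ a m′≤m)) (sym (Fin.toℕ-inject≤ b m′≤m))

𝟙 : Dec A → ℕ
𝟙 d = if does d then 1 else 0

𝟙-yes : (d : Dec A) → A → 𝟙 d ≡ 1
𝟙-yes (yes _) _ = refl
𝟙-yes (no ¬a) a = contradiction a ¬a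

𝟙-no : (d : Dec A) → ¬ A → 𝟙 d ≡ 0
𝟙-no (yes a) ¬a = contradiction a ¬a
𝟙-no (no _) _ = refl

𝟙-mono : (d : Dec A) (e : Dec B) → (A → B) → 𝟙 d ≤ 𝟙 e
𝟙-mono (yes a) e f = ≤-reflexive (sym (𝟙-yes e (f a)))
𝟙-mono (no _) e f = z≤n

𝟙-cong : (d : Dec A) (e : Dec B) → (A → B) → (B → A) → 𝟙 d ≡ 𝟙 e
𝟙-cong d e f g = ≤-antisym (𝟙-mono d e f) (𝟙-mono e d g)

∑-mono : {f g : Fin k → ℕ} → (∀ i → f i ≤ g i) → ∑[ i < k ] f i ≤ ∑[ i < k ] g i
∑-mono {zero} f≤g = z≤n
∑-mono {suc k} f≤g = +-mono-≤ (f≤g zero) (∑-mono (f≤g ∘ suc))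

∑-const : ∀ k c → ∑[ i < k ] c ≡ k * c
∑-const zero c = refl
∑-const (suc k) c = cong (c +_) (∑-const k c)

∑-vanishing : ∀ (f : Fin k → ℕ) j → (∀ i → i ≢ j → f i ≡ 0) → ∑[ i < k ] f i ≡ f j
∑-vanishing {suc k} f zero f≡0 = begin
  f zero + ∑[ i < k ] f (suc i) ≡⟨ cong (f zero +_) (sum-cong-≗ (λ i → f≡0 (suc i) λ ())) ⟩
  f zero + ∑[ i < k ] 0         ≡⟨ cong (f zero +_) (∑-const k 0) ⟩
  f zero + k * 0                ≡⟨ cong (f zero +_) (*-zeroʳ k) ⟩
  f zero + 0                    ≡⟨ +-identityʳ (f zero) ⟩
  f zero                        ∎
  where open ≡-Reasoning
∑-vanishing {suc k} f (suc j) f≡0 =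
  trans (cong (_+ ∑[ i < k ] f (suc i)) (f≡0 zero λ ()))
        (∑-vanishing (f ∘ suc) j λ i i≢j → f≡0 (suc i) (i≢j ∘ Fin.suc-injective))

∑-𝟙≟ : ∀ (j : Fin k) → ∑[ i < k ] 𝟙 (j Fin.≟ i) ≡ 1
∑-𝟙≟ j = trans (∑-vanishing _ j λ i i≢j → 𝟙-no (j Fin.≟ i) (i≢j ∘ sym)) (𝟙-yes (j Fin.≟ j) refl)

record Weighting (A : Set) : Set where
  field
    ∫      : (A → ℕ) → ℕ
    ∫-mono : {f g : A → ℕ} → (∀ x → f x ≤ g x) → ∫ f ≤ ∫ g
    ∫-+    : ∀ f g → ∫ (λ x → f x + g x) ≡ ∫ f + ∫ g
    ∫-0    : ∫ (λ _ → 0) ≡ 0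

  mass : ℕ
  mass = ∫ λ _ → 1

  ∫-cong : {f g : A → ℕ} → (∀ x → f x ≡ g x) → ∫ f ≡ ∫ g
  ∫-cong f≡g = ≤-antisym (∫-mono (≤-reflexive ∘ f≡g)) (∫-mono (≤-reflexive ∘ sym ∘ f≡g))

  ∫-*ˡ : ∀ c f → ∫ (λ x → c * f x) ≡ c * ∫ f
  ∫-*ˡ zero f = ∫-0
  ∫-*ˡ (suc c) f = trans (∫-+ f _) (cong (∫ f +_) (∫-*ˡ c f))

  ∫-const : ∀ c → ∫ (λ _ → c) ≡ c * mass
  ∫-const c = trans (∫-cong λ _ → sym (*-identityʳ c)) (∫-*ˡ c _)

  ∫-∑ : ∀ (f : A → Fin k → ℕ) → ∫ (λ x → ∑[ i < k ] f x i) ≡ ∑[ i < k ] ∫ (λ x → f x i)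
  ∫-∑ {zero} f = ∫-0
  ∫-∑ {suc k} f = trans (∫-+ _ _) (cong (∫ (λ x → f x zero) +_) (∫-∑ (λ x → f x ∘ suc)))

open Weighting public

counting : ∀ k → Weighting (Fin k)
counting k = record
  { ∫ = sum ; ∫-mono = ∑-mono ; ∫-+ = ∑-distrib-+ ; ∫-0 = trans (∑-const k 0) (*-zeroʳ k) }

pushforward : (B → A) → Weighting B → Weighting A
pushforward h μ = record
  { ∫ = λ f → ∫ μ (f ∘ h)
  ; ∫-mono = λ f≤g → ∫-mono μ (f≤g ∘ h)
  ; ∫-+ = λ f g → ∫-+ μ (f ∘ h) (g ∘ h)
  ; ∫-0 = ∫-0 μ
  }

infixl 6 _+ʷ_
infix 7 _·δ_

_+ʷ_ : Weighting A → Weighting A → Weighting A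
μ +ʷ ν = record
  { ∫ = λ f → ∫ μ f + ∫ ν f
  ; ∫-mono = λ f≤g → +-mono-≤ (∫-mono μ f≤g) (∫-mono ν f≤g)
  ; ∫-+ = λ f g → trans (cong₂ _+_ (∫-+ μ f g) (∫-+ ν f g)) (interchange (∫ μ f) (∫ μ g) (∫ ν f) (∫ ν g))
  ; ∫-0 = cong₂ _+_ (∫-0 μ) (∫-0 ν)
  }

_·δ_ : ℕ → A → Weighting A
c ·δ x = record
  { ∫ = λ f → c * f x
  ; ∫-mono = λ f≤g → *-monoʳ-≤ c (f≤g x)
  ; ∫-+ = λ f g → *-distribˡ-+ c (f x) (g x)
  ; ∫-0 = *-zeroʳ c
  }

vectors : ∀ n r → Weighting (Vec (Fin n) r)
vectors n zero = record { ∫ = λ f → f [] ; ∫-mono = λ f≤g → f≤g [] ; ∫-+ = λ _ _ → refl ; ∫-0 = refl }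
vectors n (suc r) = record
  { ∫ = λ f → ∑[ a < n ] ∫ (vectors n r) (f ∘ (a ∷_))
  ; ∫-mono = λ f≤g → ∑-mono (λ a → ∫-mono (vectors n r) (f≤g ∘ (a ∷_)))
  ; ∫-+ = λ f g → trans (sum-cong-≗ (λ a → ∫-+ (vectors n r) (f ∘ (a ∷_)) (g ∘ (a ∷_))))
                        (∑-distrib-+ (λ a → ∫ (vectors n r) (f ∘ (a ∷_))) (λ a → ∫ (vectors n r) (g ∘ (a ∷_))))
  ; ∫-0 = trans (sum-cong-≗ {n} (λ _ → ∫-0 (vectors n r))) (∫-0 (counting n))
  }

mass-vectors : ∀ n r → mass (vectors n r) ≡ n ^ r
mass-vectors n zero = refl
mass-vectors n (suc r) = trans (sum-cong-≗ {n} (λ _ → mass-vectors n r)) (∑-const n (n ^ r))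

∫-vectors-lines : ∀ {k r} (F : Vec (Fin (suc k)) (suc r) → ℕ) (i : Fin (suc r)) →
                  (∀ φ → ∑[ b < suc k ] F (φ [ i ]≔ b) ≡ 1) → ∫ (vectors (suc k) (suc r)) F ≡ suc k ^ r
∫-vectors-lines {k} {r} F zero lines = begin
  ∑[ a < suc k ] ∫ (vectors (suc k) r) (λ φ → F (a ∷ φ))   ≡⟨ ∫-∑ (vectors (suc k) r) (λ φ a → F (a ∷ φ)) ⟨
  ∫ (vectors (suc k) r) (λ φ → ∑[ a < suc k ] F (a ∷ φ))   ≡⟨ ∫-cong (vectors (suc k) r) (λ φ → lines (zero ∷ φ)) ⟩
  mass (vectors (suc k) r)                                  ≡⟨ mass-vectors (suc k) r ⟩
  suc k ^ r                                                 ∎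
  where open ≡-Reasoning
∫-vectors-lines {k} {suc r} F (suc i) lines =
  trans (sum-cong-≗ {suc k} (λ a → ∫-vectors-lines (F ∘ (a ∷_)) i (lines ∘ (a ∷_)))) (∑-const (suc k) (suc k ^ r))

isSol? : (g : Fin N → Fin n) (z : Fin N × Fin N) → Dec (IsSol (PHP N n) g z)
isSol? g (a , b) = (a Fin.<? b) ×-dec (g a Fin.≟ g b)

collisions : (Fin N → Fin n) → ℕ
collisions {N} g = ∑[ a < N ] ∑[ b < N ] 𝟙 (isSol? g (a , b))

fibre : (Fin N → Fin n) → Fin n → ℕ
fibre {N} g c = ∑[ a < N ] 𝟙 (g a Fin.≟ c)

∑-fibre : (g : Fin N → Fin n) → ∑[ c < n ] fibre g c ≡ N
∑-fibre {N} {n} g = begin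
  ∑[ c < n ] ∑[ a < N ] 𝟙 (g a Fin.≟ c) ≡⟨ ∑-comm (λ c a → 𝟙 (g a Fin.≟ c)) ⟩
  ∑[ a < N ] ∑[ c < n ] 𝟙 (g a Fin.≟ c) ≡⟨ sum-cong-≗ (∑-𝟙≟ ∘ g) ⟩
  ∑[ a < N ] 1                          ≡⟨ trans (∑-const N 1) (*-identityʳ N) ⟩
  N                                     ∎
  where open ≡-Reasoning

𝟙-sameHole : (g : Fin N → Fin n) (a b : Fin N) →
             𝟙 (g b Fin.≟ g a) ≡ 𝟙 (isSol? g (a , b)) + 𝟙 (isSol? g (b , a)) + 𝟙 (a Fin.≟ b)
𝟙-sameHole g a b with Fin.<-cmp a b
... | tri< a<b a≢b _
  rewrite 𝟙-no (isSol? g (b , a)) (Fin.<-asym a<b ∘ proj₁) | 𝟙-no (a Fin.≟ b) a≢b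
        | +-identityʳ (𝟙 (isSol? g (a , b)) + 0) | +-identityʳ (𝟙 (isSol? g (a , b)))
  = 𝟙-cong (g b Fin.≟ g a) (isSol? g (a , b)) (λ e → a<b , sym e) (sym ∘ proj₂)
... | tri> _ a≢b b<a
  rewrite 𝟙-no (isSol? g (a , b)) (Fin.<-asym b<a ∘ proj₁) | 𝟙-no (a Fin.≟ b) a≢b
        | +-identityʳ (𝟙 (isSol? g (b , a)))
  = 𝟙-cong (g b Fin.≟ g a) (isSol? g (b , a)) (b<a ,_) proj₂
... | tri≈ _ refl _
  rewrite 𝟙-no (isSol? g (a , a)) (Fin.<-irrefl refl ∘ proj₁) | 𝟙-yes (a Fin.≟ a) refl
  = 𝟙-yes (g a Fin.≟ g a) refl

∑-fibre² : (g : Fin N → Fin n) → ∑[ c < n ] (fibre g c * fibre g c) ≡ ∑[ a < N ] ∑[ b < N ] 𝟙 (g b Fin.≟ g a)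
∑-fibre² {N} {n} g = begin
  ∑[ c < n ] (fibre g c * fibre g c)
    ≡⟨ sum-cong-≗ (λ c → *-distribʳ-sum (fibre g c) (λ a → 𝟙 (g a Fin.≟ c))) ⟩
  ∑[ c < n ] ∑[ a < N ] (𝟙 (g a Fin.≟ c) * fibre g c)
    ≡⟨ ∑-comm (λ c a → 𝟙 (g a Fin.≟ c) * fibre g c) ⟩
  ∑[ a < N ] ∑[ c < n ] (𝟙 (g a Fin.≟ c) * fibre g c)
    ≡⟨ sum-cong-≗ (λ a → ∑-vanishing _ (g a) λ c c≢ga → cong (_* fibre g c) (𝟙-no (g a Fin.≟ c) (c≢ga ∘ sym))) ⟩
  ∑[ a < N ] (𝟙 (g a Fin.≟ g a) * fibre g (g a))
    ≡⟨ sum-cong-≗ (λ a → cong (_* fibre g (g a)) (𝟙-yes (g a Fin.≟ g a) refl)) ⟩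
  ∑[ a < N ] (1 * fibre g (g a))
    ≡⟨ sum-cong-≗ (λ a → *-identityˡ (fibre g (g a))) ⟩
  ∑[ a < N ] ∑[ b < N ] 𝟙 (g b Fin.≟ g a) ∎
  where open ≡-Reasoning

∑∑-sameHole : (g : Fin N → Fin n) → ∑[ a < N ] ∑[ b < N ] 𝟙 (g b Fin.≟ g a) ≡ collisions g + collisions g + N
∑∑-sameHole {N} g = begin
  ∑[ a < N ] ∑[ b < N ] 𝟙 (g b Fin.≟ g a)
    ≡⟨ sum-cong-≗ (λ a → sum-cong-≗ (𝟙-sameHole g a)) ⟩
  ∑[ a < N ] ∑[ b < N ] (sol a b + sol b a + 𝟙 (a Fin.≟ b))
    ≡⟨ sum-cong-≗ (λ a → ∑-split a) ⟩
  ∑[ a < N ] (∑[ b < N ] sol a b + ∑[ b < N ] sol b a + 1)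
    ≡⟨ ∑-distrib-+ (λ a → ∑[ b < N ] sol a b + ∑[ b < N ] sol b a) (λ _ → 1) ⟩
  ∑[ a < N ] (∑[ b < N ] sol a b + ∑[ b < N ] sol b a) + ∑[ a < N ] 1
    ≡⟨ cong₂ _+_ (∑-distrib-+ (λ a → ∑[ b < N ] sol a b) (λ a → ∑[ b < N ] sol b a))
                 (trans (∑-const N 1) (*-identityʳ N)) ⟩
  collisions g + ∑[ a < N ] ∑[ b < N ] sol b a + N
    ≡⟨ cong (λ x → collisions g + x + N) (∑-comm (λ a b → sol b a)) ⟩
  collisions g + collisions g + N ∎
  where
  open ≡-Reasoning
  sol : Fin N → Fin N → ℕ
  sol a b = 𝟙 (isSol? g (a , b))
  ∑-split : ∀ a → ∑[ b < N ] (sol a b + sol b a + 𝟙 (a Fin.≟ b)) ≡ ∑[ b < N ] sol a b + ∑[ b < N ] sol b a + 1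
  ∑-split a = begin
    ∑[ b < N ] (sol a b + sol b a + 𝟙 (a Fin.≟ b))
      ≡⟨ ∑-distrib-+ (λ b → sol a b + sol b a) (λ b → 𝟙 (a Fin.≟ b)) ⟩
    ∑[ b < N ] (sol a b + sol b a) + ∑[ b < N ] 𝟙 (a Fin.≟ b)
      ≡⟨ cong₂ _+_ (∑-distrib-+ (sol a) (λ b → sol b a)) (∑-𝟙≟ a) ⟩
    ∑[ b < N ] sol a b + ∑[ b < N ] sol b a + 1 ∎

-- equivalent to (s - q) (s - q - 1) ≥ 0
[2q+1]s≤s²+q[q+1] : ∀ s q → (q + suc q) * s ≤ s * s + q * suc q
[2q+1]s≤s²+q[q+1] zero q = ≤-trans (≤-reflexive (*-zeroʳ (q + suc q))) z≤n
[2q+1]s≤s²+q[q+1] (suc s) zero =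
  ≤-trans (*-monoˡ-≤ (suc s) (s≤s (z≤n {s}))) (m≤m+n (suc s * suc s) 0)
[2q+1]s≤s²+q[q+1] (suc s) (suc q) = begin
  (suc q + suc (suc q)) * suc s              ≡⟨ shift₁ s q ⟩
  (q + suc q) * s + (s + s + q + q + 3)      ≤⟨ +-monoˡ-≤ _ ([2q+1]s≤s²+q[q+1] s q) ⟩
  s * s + q * suc q + (s + s + q + q + 3)    ≡⟨ shift₂ s q ⟩
  suc s * suc s + suc q * suc (suc q)        ∎
  where
  open ≤-Reasoning
  shift₁ : ∀ s q → (suc q + suc (suc q)) * suc s ≡ (q + suc q) * s + (s + s + q + q + 3)
  shift₁ = solve-∀
  shift₂ : ∀ s q → s * s + q * suc q + (s + s + q + q + 3) ≡ suc s * suc s + suc q * suc (suc q)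
  shift₂ = solve-∀

collisions-lowerBound : ∀ (g : Fin N → Fin n) q →
                        (q + suc q) * N ≤ collisions g + collisions g + N + n * (q * suc q)
collisions-lowerBound {N} {n} g q = begin
  (q + suc q) * N                                        ≡⟨ cong ((q + suc q) *_) (∑-fibre g) ⟨
  (q + suc q) * ∑[ c < n ] fibre g c                     ≡⟨ *-distribˡ-sum (q + suc q) (fibre g) ⟩
  ∑[ c < n ] ((q + suc q) * fibre g c)                   ≤⟨ ∑-mono (λ c → [2q+1]s≤s²+q[q+1] (fibre g c) q) ⟩
  ∑[ c < n ] (fibre g c * fibre g c + q * suc q)         ≡⟨ ∑-distrib-+ (λ c → fibre g c * fibre g c) (λ _ → q * suc q) ⟩
  ∑[ c < n ] (fibre g c * fibre g c) + ∑[ c < n ] (q * suc q)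
                                                         ≡⟨ cong₂ _+_ (trans (∑-fibre² g) (∑∑-sameHole g)) (∑-const n _) ⟩
  collisions g + collisions g + N + n * (q * suc q)      ∎
  where open ≤-Reasoning

triangular : ℕ → ℕ
triangular zero = 0
triangular (suc n) = n + triangular n

triangular-double : ∀ m → triangular (suc m) + triangular (suc m) ≡ suc m * m
triangular-double zero = refl
triangular-double (suc m) = begin
  (suc m + t) + (suc m + t)   ≡⟨ regroup (suc m) t ⟩
  suc m + suc m + (t + t)     ≡⟨ cong (suc m + suc m +_) (triangular-double m) ⟩
  suc m + suc m + suc m * m   ≡⟨ expand m ⟩
  suc (suc m) * suc m         ∎
  where
  open ≡-Reasoning
  t : ℕ
  t = triangular (suc m)
  regroup : ∀ a b → (a + b) + (a + b) ≡ a + a + (b + b)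
  regroup = solve-∀
  expand : ∀ m → suc m + suc m + suc m * m ≡ suc (suc m) * suc m
  expand = solve-∀

∑∑-𝟙< : ∀ N → ∑[ a < N ] ∑[ b < N ] 𝟙 (a Fin.<? b) ≡ triangular N
∑∑-𝟙< zero = refl
∑∑-𝟙< (suc N) = cong₂ _+_ (trans (∑-const N 1) (*-identityʳ N)) (∑∑-𝟙< N)

module _ {P : Problem} {M n : ℕ} (R : P ≤ᵖ PHP (suc M) n) (sol? : ∀ x z → Dec (IsSol P x z))
         (μ : Weighting (Inst P)) (L : ℕ) (load≤ : ∀ z → ∫ μ (λ x → 𝟙 (sol? x z)) ≤ L) where
  open _≤ᵖ_ R

  pair-load : Fin (suc M) → Fin (suc M) → ℕ
  pair-load a b = ∫ μ (λ x → 𝟙 (isSol? (Φ x) (a , b)))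

  pair-load≡0 : ∀ {a b} → (∀ x → ¬ IsSol (PHP (suc M) n) (Φ x) (a , b)) → pair-load a b ≡ 0
  pair-load≡0 {a} {b} unsolvable = trans (∫-cong μ (λ x → 𝟙-no (isSol? (Φ x) (a , b)) (unsolvable x))) (∫-0 μ)

  pair-load≤ : ∀ a b → pair-load a b ≤ 𝟙 (a Fin.<? b) * L
  pair-load≤ a b with a Fin.<? b | Ψ (a , b) in Ψab
  ... | no a≮b  | _       = ≤-trans (≤-reflexive (pair-load≡0 λ _ → a≮b ∘ proj₁)) z≤n
  ... | yes a<b | nothing = ≤-trans (≤-reflexive (pair-load≡0 unsolvable)) z≤n
    where
    unsolvable : ∀ x → ¬ IsSol (PHP (suc M) n) (Φ x) (a , b)
    unsolvable x s with () ← trans (sym Ψab) (proj₁ (proj₂ (correct x (a , b) s)))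
  ... | yes a<b | just z  = begin
    pair-load a b             ≤⟨ ∫-mono μ (λ x → 𝟙-mono (isSol? (Φ x) (a , b)) (sol? x z) (transfer x)) ⟩
    ∫ μ (λ x → 𝟙 (sol? x z))  ≤⟨ load≤ z ⟩
    L                         ≡⟨ +-identityʳ L ⟨
    1 * L                     ≡⟨ cong (_* L) (𝟙-yes (a Fin.<? b) a<b) ⟨
    𝟙 (a Fin.<? b) * L        ∎
    where
    open ≤-Reasoning
    transfer : ∀ x → IsSol (PHP (suc M) n) (Φ x) (a , b) → IsSol P x z
    transfer x s with correct x (a , b) s
    ... | z′ , Ψab′ , s′ = subst (IsSol P x) (just-injective (trans (sym Ψab′) Ψab)) s′

  ∫-collisions≤ : ∫ μ (collisions ∘ Φ) ≤ triangular (suc M) * L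
  ∫-collisions≤ = begin
    ∫ μ (λ x → ∑[ a < suc M ] ∑[ b < suc M ] 𝟙 (isSol? (Φ x) (a , b)))
      ≡⟨ ∫-∑ μ (λ x a → ∑[ b < suc M ] 𝟙 (isSol? (Φ x) (a , b))) ⟩
    ∑[ a < suc M ] ∫ μ (λ x → ∑[ b < suc M ] 𝟙 (isSol? (Φ x) (a , b)))
      ≡⟨ sum-cong-≗ (λ a → ∫-∑ μ (λ x b → 𝟙 (isSol? (Φ x) (a , b)))) ⟩
    ∑[ a < suc M ] ∑[ b < suc M ] pair-load a b
      ≤⟨ ∑-mono (λ a → ∑-mono (pair-load≤ a)) ⟩
    ∑[ a < suc M ] ∑[ b < suc M ] (𝟙 (a Fin.<? b) * L)
      ≡⟨ sum-cong-≗ {suc M} (λ a → *-distribʳ-sum {suc M} L (λ b → 𝟙 (a Fin.<? b))) ⟨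
    ∑[ a < suc M ] (∑[ b < suc M ] 𝟙 (a Fin.<? b) * L)
      ≡⟨ *-distribʳ-sum {suc M} L (λ a → ∑[ b < suc M ] 𝟙 (a Fin.<? b)) ⟨
    (∑[ a < suc M ] ∑[ b < suc M ] 𝟙 (a Fin.<? b)) * L
      ≡⟨ cong (_* L) (∑∑-𝟙< (suc M)) ⟩
    triangular (suc M) * L ∎
    where open ≤-Reasoning

  reduction-bound : ∀ q → (q + suc q) * suc M * mass μ ≤ suc M * M * L + (suc M + n * (q * suc q)) * mass μ
  reduction-bound q = begin
    (q + suc q) * suc M * mass μ
      ≡⟨ ∫-const μ _ ⟨
    ∫ μ (λ _ → (q + suc q) * suc M)
      ≤⟨ ∫-mono μ (λ x → collisions-lowerBound (Φ x) q) ⟩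
    ∫ μ (λ x → collisions (Φ x) + collisions (Φ x) + suc M + n * (q * suc q))
      ≡⟨ ∫-cong μ (λ x → +-assoc (collisions (Φ x) + collisions (Φ x)) (suc M) _) ⟩
    ∫ μ (λ x → (collisions (Φ x) + collisions (Φ x)) + (suc M + n * (q * suc q)))
      ≡⟨ ∫-+ μ _ _ ⟩
    ∫ μ (λ x → collisions (Φ x) + collisions (Φ x)) + ∫ μ (λ _ → suc M + n * (q * suc q))
      ≡⟨ cong₂ _+_ (∫-+ μ (collisions ∘ Φ) (collisions ∘ Φ)) (∫-const μ _) ⟩
    ∫ μ (collisions ∘ Φ) + ∫ μ (collisions ∘ Φ) + (suc M + n * (q * suc q)) * mass μ
      ≤⟨ +-monoˡ-≤ _ (+-mono-≤ ∫-collisions≤ ∫-collisions≤) ⟩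
    triangular (suc M) * L + triangular (suc M) * L + (suc M + n * (q * suc q)) * mass μ
      ≡⟨ cong (_+ (suc M + n * (q * suc q)) * mass μ) double ⟩
    suc M * M * L + (suc M + n * (q * suc q)) * mass μ ∎
    where
    open ≤-Reasoning
    double : triangular (suc M) * L + triangular (suc M) * L ≡ suc M * M * L
    double = trans (sym (*-distribʳ-+ L (triangular (suc M)) _)) (cong (_* L) (triangular-double M))

≤-by-gap : ∀ {a b} g → a + g ≡ b → a ≤ b
≤-by-gap {a} g refl = m≤m+n a g

<-by-gap : ∀ {a b g} → 0 < g → a + g ≡ b → a < b
<-by-gap {a} 0<g refl = m<m+n a 0<g

idP≰PHP : ∀ {K M n} q → suc M * M + (suc M + n * (q * suc q)) * K < (q + suc q) * suc M * K →
          ¬ (idP K ≤ᵖ PHP (suc M) n)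
idP≰PHP {K} {M} {n} q gap R = <⇒≱ gap (begin
  (q + suc q) * suc M * K                                  ≡⟨ cong ((q + suc q) * suc M *_) mass≡K ⟨
  (q + suc q) * suc M * mass μ                             ≤⟨ reduction-bound R sol? μ 1 load≤1 q ⟩
  suc M * M * 1 + (suc M + n * (q * suc q)) * mass μ       ≡⟨ cong₂ _+_ (*-identityʳ (suc M * M))
                                                                        (cong ((suc M + n * (q * suc q)) *_) mass≡K) ⟩
  suc M * M + (suc M + n * (q * suc q)) * K                ∎)
  where
  open ≤-Reasoning
  μ : Weighting (Fin K)
  μ = counting K
  sol? : ∀ x z → Dec (z ≡ x)
  sol? x z = z Fin.≟ x
  load≤1 : ∀ z → ∫ μ (λ x → 𝟙 (sol? x z)) ≤ 1
  load≤1 z = ≤-reflexive (∑-𝟙≟ z)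
  mass≡K : mass μ ≡ K
  mass≡K = trans (∑-const K 1) (*-identityʳ K)

DisjointSolutions : (Fin k → Fin N → Fin n) → Set
DisjointSolutions {N = N} {n} F = ∀ {s t z} → IsSol (PHP N n) (F s) z → IsSol (PHP N n) (F t) z → s ≡ t

idP≤PHP : (F : Fin k → Fin N → Fin n) → DisjointSolutions F → idP k ≤ᵖ PHP N n
idP≤PHP {k} {N} {n} F disjoint = record { Φ = F ; Ψ = Ψ ; correct = correct }
  where
  Ψ : Fin N × Fin N → Maybe (Fin k)
  Ψ z with Fin.any? (λ t → isSol? (F t) z)
  ... | yes (t , _) = just t
  ... | no _        = nothing
  correct : ∀ s z → IsSol (PHP N n) (F s) z → ∃ λ t → Ψ z ≡ just t × t ≡ s
  correct s z sol with Fin.any? (λ t → isSol? (F t) z)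
  ... | yes (t , sol′) = t , refl , disjoint sol′ sol
  ... | no none        = contradiction (s , sol) none

decodePair : ∀ N → Fin (triangular N) → Fin N × Fin N
decodePair (suc N) c = [ (λ b → zero , suc b) , Product.map suc suc ∘ decodePair N ]′ (Fin.splitAt N c)

decodePair-< : ∀ N c → proj₁ (decodePair N c) Fin.< proj₂ (decodePair N c)
decodePair-< (suc N) c with Fin.splitAt N c
... | inj₁ _ = s≤s z≤n
... | inj₂ c′ = s≤s (decodePair-< N c′)

encodePair : ∀ {N} (a b : Fin N) → a Fin.< b → Fin (triangular N)
encodePair {suc N} zero    (suc b) _         = b Fin.↑ˡ triangular N
encodePair {suc N} (suc a) (suc b) (s≤s a<b) = N Fin.↑ʳ encodePair a b a<b

decode-encode : ∀ {N} (a b : Fin N) (a<b : a Fin.< b) → decodePair N (encodePair a b a<b) ≡ (a , b)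
decode-encode {suc N} zero (suc b) _
  rewrite Fin.splitAt-↑ˡ N b (triangular N) = refl
decode-encode {suc N} (suc a) (suc b) (s≤s a<b)
  rewrite Fin.splitAt-↑ʳ N (triangular N) (encodePair a b a<b) | decode-encode a b a<b = refl

encode-decode : ∀ N c → encodePair (proj₁ (decodePair N c)) (proj₂ (decodePair N c)) (decodePair-< N c) ≡ c
encode-decode (suc N) c with Fin.splitAt N c in split≡
... | inj₁ b  = Fin.splitAt⁻¹-↑ˡ split≡
... | inj₂ c′ = trans (cong (N Fin.↑ʳ_) (encode-decode N c′)) (Fin.splitAt⁻¹-↑ʳ split≡)

decodePair-injective : ∀ N {c c′} → decodePair N c ≡ decodePair N c′ → c ≡ c′
decodePair-injective N {c} {c′} eq = begin
  c                                                       ≡⟨ encode-decode N c ⟨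
  encodePair (proj₁ (decodePair N c)) _ (decodePair-< N c)  ≡⟨ encodePair-cong eq _ _ ⟩
  encodePair (proj₁ (decodePair N c′)) _ (decodePair-< N c′) ≡⟨ encode-decode N c′ ⟩
  c′                                                      ∎
  where
  open ≡-Reasoning
  encodePair-cong : ∀ {a b a′ b′} → (a , b) ≡ (a′ , b′) → (a<b : a Fin.< b) (a′<b′ : a′ Fin.< b′) →
                    encodePair a b a<b ≡ encodePair a′ b′ a′<b′
  encodePair-cong refl a<b a<b′ = cong (encodePair _ _) (Fin.<-irrelevant a<b a<b′)

-- Send b to the hole of a and close up the gap: {a , b} is then the only collision.
merge : (a b : Fin (suc n)) → a ≢ b → Fin (suc n) → Fin n
merge a b a≢b i with b Fin.≟ i
... | yes _   = Fin.punchOut (a≢b ∘ sym)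
... | no b≢i = Fin.punchOut b≢i

merge-solution : ∀ {a b : Fin (suc n)} (a<b : a Fin.< b) {z} →
                 IsSol (PHP (suc n) n) (merge a b (Fin.<⇒≢ a<b)) z → z ≡ (a , b)
merge-solution {a = a} {b} a<b {i , j} (i<j , e) with b Fin.≟ i | b Fin.≟ j
... | yes refl | yes refl = contradiction i<j (Fin.<-irrefl refl)
... | yes refl | no b≢j   = contradiction (subst (b Fin.<_) (sym (Fin.punchOut-injective _ b≢j e)) i<j) (Fin.<-asym a<b)
... | no b≢i   | yes refl = cong (_, b) (Fin.punchOut-injective b≢i _ e)
... | no b≢i   | no b≢j   = contradiction (Fin.punchOut-injective b≢i b≢j e) (Fin.<⇒≢ i<j)

idP-triangular≤PHP : ∀ n → idP (triangular (suc n)) ≤ᵖ PHP (suc n) n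
idP-triangular≤PHP n = idP≤PHP F disjoint
  where
  F : Fin (triangular (suc n)) → Fin (suc n) → Fin n
  F c = merge _ _ (Fin.<⇒≢ (decodePair-< (suc n) c))
  disjoint : DisjointSolutions F
  disjoint {s} {t} sol sol′ = decodePair-injective (suc n)
    (trans (sym (merge-solution (decodePair-< (suc n) s) sol)) (merge-solution (decodePair-< (suc n) t) sol′))

PHP≤idP-triangular : ∀ n → PHP (suc n) n ≤ᵖ idP (triangular (suc n))
PHP≤idP-triangular n = record { Φ = Φ ; Ψ = just ∘ decodePair (suc n) ; correct = correct }
  where
  Φ : (Fin (suc n) → Fin n) → Fin (triangular (suc n))
  Φ f = let (a , b , a<b , _) = Fin.pigeonhole (n<1+n n) f in encodePair a b a<b
  correct : ∀ f c → c ≡ Φ f → ∃ λ z → just (decodePair (suc n) c) ≡ just z × IsSol (PHP (suc n) n) f z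
  correct f c refl = let (a , b , a<b , e) = Fin.pigeonhole (n<1+n n) f in
    (a , b) , cong just (decode-encode a b a<b) , a<b , e

C2≡triangular : ∀ m → m C 2 ≡ triangular m
C2≡triangular zero = refl
C2≡triangular (suc m) = trans (sym (nCk+nC[k+1]≡[n+1]C[k+1] m 1)) (cong₂ _+_ (nC1≡n m) (C2≡triangular m))

idP[C[n+1,2]]≡PHP[n+1] : ∀ n → idP ((n + 1) C 2) ≡ᵖ PHP (n + 1) n
idP[C[n+1,2]]≡PHP[n+1] n rewrite +-comm n 1 | C2≡triangular (suc n) =
  idP-triangular≤PHP n , PHP≤idP-triangular n

%-cong-+ : ∀ {a a′ b b′} m .{{_ : NonZero m}} → a % m ≡ a′ % m → b % m ≡ b′ % m → (a + b) % m ≡ (a′ + b′) % m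
%-cong-+ {a} {a′} {b} {b′} m a≡a′ b≡b′ = begin
  (a + b) % m             ≡⟨ %-distribˡ-+ a b m ⟩
  (a % m + b % m) % m     ≡⟨ cong₂ (λ x y → (x + y) % m) a≡a′ b≡b′ ⟩
  (a′ % m + b′ % m) % m   ≡⟨ %-distribˡ-+ a′ b′ m ⟨
  (a′ + b′) % m           ∎
  where open ≡-Reasoning

%-cong-*ˡ : ∀ {a b} c m .{{_ : NonZero m}} → a % m ≡ b % m → (c * a) % m ≡ (c * b) % m
%-cong-*ˡ {a} {b} c m a≡b = begin
  (c * a) % m             ≡⟨ %-distribˡ-* c a m ⟩
  (c % m * (a % m)) % m   ≡⟨ cong (λ x → (c % m * x) % m) a≡b ⟩
  (c % m * (b % m)) % m   ≡⟨ %-distribˡ-* c b m ⟨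
  (c * b) % m             ∎
  where open ≡-Reasoning

[m%d+n]%d≡[m+n]%d : ∀ a b m .{{_ : NonZero m}} → (a % m + b) % m ≡ (a + b) % m
[m%d+n]%d≡[m+n]%d a b m = %-cong-+ m (m%n%n≡m%n a m) refl

%-injective : ∀ {a b m} .{{_ : NonZero m}} → a < m → b < m → a % m ≡ b % m → a ≡ b
%-injective a<m b<m a≡b = trans (sym (m<n⇒m%n≡m a<m)) (trans a≡b (m<n⇒m%n≡m b<m))

+-%-cancelʳ : ∀ a b c k → (a + c) % suc k ≡ (b + c) % suc k → a % suc k ≡ b % suc k
+-%-cancelʳ a b c k eq = begin
  a % suc k                      ≡⟨ [m+kn]%n≡m%n a c (suc k) ⟨
  (a + c * suc k) % suc k        ≡⟨ cong (_% suc k) (shift a c k) ⟩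
  ((a + c) + c * k) % suc k      ≡⟨ %-cong-+ {a + c} {b + c} {c * k} {c * k} (suc k) eq refl ⟩
  ((b + c) + c * k) % suc k      ≡⟨ cong (_% suc k) (shift b c k) ⟨
  (b + c * suc k) % suc k        ≡⟨ [m+kn]%n≡m%n b c (suc k) ⟩
  b % suc k                      ∎
  where
  open ≡-Reasoning
  shift : ∀ a c k → a + c * suc k ≡ (a + c) + c * k
  shift = solve-∀

-- The round-robin 1-factorisation of the complete graph on ℤ/m ∪ {∞}, m = 2k+1, with ∞ represented
-- by m: in round t the point p is matched with 2t - p, and t with ∞; the colour of p is its distance
-- from t on the circle.
module RoundRobin (k : ℕ) where
  m : ℕ
  m = suc (k + k)

  offset : ℕ → ℕ → ℕ
  offset t p = (p + (m ∸ t)) % m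

  offset-+ : ∀ {t} p → t ≤ m → (offset t p + t) % m ≡ p % m
  offset-+ {t} p t≤m = begin
    ((p + (m ∸ t)) % m + t) % m   ≡⟨ [m%d+n]%d≡[m+n]%d (p + (m ∸ t)) t m ⟩
    (p + (m ∸ t) + t) % m         ≡⟨ cong (_% m) (trans (+-assoc p (m ∸ t) t) (cong (p +_) (m∸n+n≡m t≤m))) ⟩
    (p + m) % m                   ≡⟨ [m+n]%n≡m%n p m ⟩
    p % m                         ∎
    where open ≡-Reasoning

  fold : ℕ → ℕ
  fold d with d ≤? k
  ... | yes _ = d
  ... | no _  = m ∸ d

  fold<n : ∀ d → fold d < suc k
  fold<n d with d ≤? k
  ... | yes d≤k = s≤s d≤k
  ... | no d≰k  = s≤s (≤-trans (∸-monoʳ-≤ m (≰⇒> d≰k)) (≤-reflexive (m+n∸m≡n (suc k) k)))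

  fold-injective± : ∀ {d e} → d < m → e < m → fold d ≡ fold e → d ≡ e ⊎ d + e ≡ m
  fold-injective± {d} {e} d<m e<m eq with d ≤? k | e ≤? k
  ... | yes _ | yes _ = inj₁ eq
  ... | no _  | no _  = inj₁ (∸-cancelˡ-≡ (<⇒≤ d<m) (<⇒≤ e<m) eq)
  ... | yes _ | no _  = inj₂ (trans (cong (_+ e) eq) (m∸n+n≡m (<⇒≤ e<m)))
  ... | no _  | yes _ = inj₂ (trans (cong (d +_) (sym eq)) (m+[n∸m]≡n (<⇒≤ d<m)))

  fold≡0 : ∀ {d} → d < m → fold d ≡ 0 → d ≡ 0
  fold≡0 {d} d<m eq with d ≤? k
  ... | yes _ = eq
  ... | no _  = contradiction eq (≢-sym (<⇒≢ (m<n⇒0<n∸m d<m)))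

  colour : ℕ → ℕ → ℕ
  colour t p with p ≟ m
  ... | yes _ = 0
  ... | no _  = fold (offset t p)

  colour<n : ∀ t p → colour t p < suc k
  colour<n t p with p ≟ m
  ... | yes _ = s≤s z≤n
  ... | no _  = fold<n (offset t p)

  centre : ℕ → ℕ → ℕ
  centre p q with q ≟ m
  ... | yes _ = p
  ... | no _  = (suc k * (p + q)) % m

  offset-injective : ∀ {t p q} → t ≤ m → p < m → q < m → offset t p ≡ offset t q → p ≡ q
  offset-injective {t} {p} {q} t≤m p<m q<m eq = %-injective p<m q<m (begin
    p % m                 ≡⟨ offset-+ p t≤m ⟨
    (offset t p + t) % m  ≡⟨ cong (λ d → (d + t) % m) eq ⟩
    (offset t q + t) % m  ≡⟨ offset-+ q t≤m ⟩
    q % m                 ∎)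
    where open ≡-Reasoning

  opposite-offsets : ∀ {t p q} → t ≤ m → offset t p + offset t q ≡ m → (p + q) % m ≡ (t + t) % m
  opposite-offsets {t} {p} {q} t≤m eq = begin
    (p + q) % m                             ≡⟨ %-cong-+ {offset t p + t} {p} {offset t q + t} {q} m
                                                           (offset-+ p t≤m) (offset-+ q t≤m) ⟨
    ((offset t p + t) + (offset t q + t)) % m ≡⟨ cong (_% m) (regroup (offset t p) (offset t q) t) ⟩
    ((offset t p + offset t q) + (t + t)) % m ≡⟨ cong (λ x → (x + (t + t)) % m) eq ⟩
    (m + (t + t)) % m                       ≡⟨ cong (_% m) (+-comm m (t + t)) ⟩
    ((t + t) + m) % m                       ≡⟨ [m+n]%n≡m%n (t + t) m ⟩
    (t + t) % m                             ∎
    where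
    open ≡-Reasoning
    regroup : ∀ a b c → (a + c) + (b + c) ≡ (a + b) + (c + c)
    regroup = solve-∀

  -- suc k is the inverse of 2 modulo m
  halve : ∀ {t} → t < m → (suc k * (t + t)) % m ≡ t
  halve {t} t<m = begin
    (suc k * (t + t)) % m   ≡⟨ cong (_% m) (double-inverse k t) ⟩
    (t + t * m) % m         ≡⟨ [m+kn]%n≡m%n t t m ⟩
    t % m                   ≡⟨ m<n⇒m%n≡m t<m ⟩
    t                       ∎
    where
    open ≡-Reasoning
    double-inverse : ∀ k t → suc k * (t + t) ≡ t + t * suc (k + k)
    double-inverse = solve-∀

  colour-collision : ∀ {t p q} → t < m → p < q → q ≤ m → colour t p ≡ colour t q → t ≡ centre p q
  colour-collision {t} {p} {q} t<m p<q q≤m eq with p ≟ m | q ≟ m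
  ... | yes refl | _       = contradiction (<-≤-trans p<q q≤m) (<-irrefl refl)
  ... | no _     | yes refl = %-injective t<m p<q (begin
    t % m                 ≡⟨ cong (λ d → (d + t) % m) (fold≡0 (m%n<n (p + (m ∸ t)) m) eq) ⟨
    (offset t p + t) % m  ≡⟨ offset-+ p (<⇒≤ t<m) ⟩
    p % m                 ∎)
    where open ≡-Reasoning
  ... | no _     | no q≢m  with fold-injective± (m%n<n (p + (m ∸ t)) m) (m%n<n (q + (m ∸ t)) m) eq
  ...   | inj₁ same     = contradiction (offset-injective (<⇒≤ t<m) p<m q<m same) (<⇒≢ p<q)
    where
    q<m : q < m
    q<m = ≤∧≢⇒< q≤m q≢m
    p<m : p < m
    p<m = <-trans p<q q<m
  ...   | inj₂ opposite = begin
    t                          ≡⟨ halve t<m ⟨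
    (suc k * (t + t)) % m      ≡⟨ %-cong-*ˡ {p + q} {t + t} (suc k) m (opposite-offsets {t} {p} {q} (<⇒≤ t<m) opposite) ⟨
    (suc k * (p + q)) % m      ∎
    where open ≡-Reasoning

idP[2k+1]≤PHP[2k+2] : ∀ k → idP (suc (k + k)) ≤ᵖ PHP (2 * suc k) (suc k)
idP[2k+1]≤PHP[2k+2] k = idP≤PHP F disjoint
  where
  open RoundRobin k
  F : Fin m → Fin (2 * suc k) → Fin (suc k)
  F t p = Fin.fromℕ< (colour<n (toℕ t) (toℕ p))
  toℕ≤m : ∀ (p : Fin (2 * suc k)) → toℕ p ≤ m
  toℕ≤m p = ≤-pred (subst (toℕ p <_) (2[1+k]≡1+m k) (Fin.toℕ<n p))
    where
    2[1+k]≡1+m : ∀ k → 2 * suc k ≡ suc (suc (k + k))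
    2[1+k]≡1+m = solve-∀
  collision-centre : ∀ {t p q} → IsSol (PHP (2 * suc k) (suc k)) (F t) (p , q) → toℕ t ≡ centre (toℕ p) (toℕ q)
  collision-centre {t} {p} {q} (p<q , e) = colour-collision (Fin.toℕ<n t) p<q (toℕ≤m q)
    (trans (sym (Fin.toℕ-fromℕ< _)) (trans (cong toℕ e) (Fin.toℕ-fromℕ< _)))
  disjoint : DisjointSolutions F
  disjoint {z = _ , _} sol sol′ = Fin.toℕ-injective (trans (collision-centre sol) (sym (collision-centre sol′)))

module Cyclic (k : ℕ) where

  _⊕_ : Fin (suc k) → Fin (suc k) → Fin (suc k)
  a ⊕ c = Fin.fromℕ< (m%n<n (toℕ a + toℕ c) (suc k))

  toℕ-⊕ : ∀ a c → toℕ (a ⊕ c) ≡ (toℕ a + toℕ c) % suc k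
  toℕ-⊕ a c = Fin.toℕ-fromℕ< _

  ⊕-cancelʳ : ∀ {a b} c → a ⊕ c ≡ b ⊕ c → a ≡ b
  ⊕-cancelʳ {a} {b} c eq = Fin.toℕ-injective (%-injective (Fin.toℕ<n a) (Fin.toℕ<n b)
    (+-%-cancelʳ (toℕ a) (toℕ b) (toℕ c) k (trans (sym (toℕ-⊕ a c)) (trans (cong toℕ eq) (toℕ-⊕ b c)))))

  ⊕-comm : ∀ a c → a ⊕ c ≡ c ⊕ a
  ⊕-comm a c = Fin.toℕ-injective (trans (toℕ-⊕ a c) (trans (cong (_% suc k) (+-comm (toℕ a) (toℕ c))) (sym (toℕ-⊕ c a))))

  ⊕-cancelˡ : ∀ a {c c′} → a ⊕ c ≡ a ⊕ c′ → c ≡ c′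
  ⊕-cancelˡ a {c} {c′} eq = ⊕-cancelʳ a (trans (⊕-comm c a) (trans eq (⊕-comm a c′)))

  ⊕-solve : ∀ y c → ∃ λ b → b ⊕ c ≡ y
  ⊕-solve y c = b , Fin.toℕ-injective (begin
    toℕ (b ⊕ c)                         ≡⟨ toℕ-⊕ b c ⟩
    (toℕ b + toℕ c) % suc k             ≡⟨ cong (λ x → (x + toℕ c) % suc k) (Fin.toℕ-fromℕ< b<1+k) ⟩
    ((toℕ y + toℕ c * k) % suc k + toℕ c) % suc k ≡⟨ [m%d+n]%d≡[m+n]%d (toℕ y + toℕ c * k) (toℕ c) (suc k) ⟩
    (toℕ y + toℕ c * k + toℕ c) % suc k ≡⟨ cong (_% suc k) (unshift (toℕ y) (toℕ c) k) ⟩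
    (toℕ y + toℕ c * suc k) % suc k     ≡⟨ [m+kn]%n≡m%n (toℕ y) (toℕ c) (suc k) ⟩
    toℕ y % suc k                       ≡⟨ m<n⇒m%n≡m (Fin.toℕ<n y) ⟩
    toℕ y                               ∎)
    where
    open ≡-Reasoning
    b<1+k : (toℕ y + toℕ c * k) % suc k < suc k
    b<1+k = m%n<n (toℕ y + toℕ c * k) (suc k)
    b : Fin (suc k)
    b = Fin.fromℕ< b<1+k
    unshift : ∀ y c k → y + c * k + c ≡ y + c * suc k
    unshift = solve-∀

  ∑-𝟙≟⊕ : ∀ y c → ∑[ b < suc k ] 𝟙 (y Fin.≟ b ⊕ c) ≡ 1
  ∑-𝟙≟⊕ y c = let (b₀ , b₀⊕c≡y) = ⊕-solve y c in begin
    ∑[ b < suc k ] 𝟙 (y Fin.≟ b ⊕ c)  ≡⟨ ∑-vanishing _ b₀ (λ b b≢b₀ → 𝟙-no (y Fin.≟ b ⊕ c)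
                                          λ y≡b⊕c → b≢b₀ (⊕-cancelʳ c (trans (sym y≡b⊕c) (sym b₀⊕c≡y)))) ⟩
    𝟙 (y Fin.≟ b₀ ⊕ c)                ≡⟨ 𝟙-yes (y Fin.≟ b₀ ⊕ c) (sym b₀⊕c≡y) ⟩
    1                                 ∎
    where open ≡-Reasoning

-- Under μ every pair of distinct cells (r₁ , c₁), (r₂ , c₂) collides with total weight exactly n^(n-1):
-- in the row map if r₁ = r₂, and otherwise in the n^(n-1) maps φ with φ r₁ ⊕ c₁ = φ r₂ ⊕ c₂.
module Affine (k : ℕ) where
  open Cyclic k

  cell : Fin (suc k * suc k) → Fin (suc k) × Fin (suc k)
  cell = Fin.remQuot (suc k)

  cell-injective : ∀ {u v} → cell u ≡ cell v → u ≡ v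
  cell-injective {u} {v} eq = trans (sym (Fin.combine-remQuot (suc k) u))
                                    (trans (cong (Product.uncurry Fin.combine) eq) (Fin.combine-remQuot (suc k) v))

  affine : Vec (Fin (suc k)) (suc k) → Fin (suc k * suc k) → Fin (suc k)
  affine φ u = lookup φ (proj₁ (cell u)) ⊕ proj₂ (cell u)

  row : Fin (suc k * suc k) → Fin (suc k)
  row = proj₁ ∘ cell

  μ : Weighting (Fin (suc k * suc k) → Fin (suc k))
  μ = pushforward affine (vectors (suc k) (suc k)) +ʷ (suc k ^ k) ·δ row

  mass-μ : mass μ ≡ suc k * suc k ^ k + suc k ^ k * 1
  mass-μ = cong (_+ suc k ^ k * 1) (mass-vectors (suc k) (suc k))

  collision-weight : ∀ r₁ c₁ r₂ c₂ → (r₁ , c₁) ≢ (r₂ , c₂) →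
    ∫ (vectors (suc k) (suc k)) (λ φ → 𝟙 (lookup φ r₁ ⊕ c₁ Fin.≟ lookup φ r₂ ⊕ c₂)) + suc k ^ k * 𝟙 (r₁ Fin.≟ r₂)
      ≡ suc k ^ k
  collision-weight r₁ c₁ r₂ c₂ cells≢ with r₁ Fin.≟ r₂
  ... | yes refl = begin
    ∫ V (λ φ → 𝟙 (lookup φ r₁ ⊕ c₁ Fin.≟ lookup φ r₁ ⊕ c₂)) + P * 1
      ≡⟨ cong (_+ P * 1) (trans (∫-cong V λ φ → 𝟙-no (lookup φ r₁ ⊕ c₁ Fin.≟ lookup φ r₁ ⊕ c₂)
                                                      (cells≢ ∘ cong (r₁ ,_) ∘ ⊕-cancelˡ (lookup φ r₁)))
                                (∫-0 V)) ⟩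
    0 + P * 1
      ≡⟨ *-identityʳ P ⟩
    P ∎
    where
    open ≡-Reasoning
    V : Weighting (Vec (Fin (suc k)) (suc k))
    V = vectors (suc k) (suc k)
    P : ℕ
    P = suc k ^ k
  ... | no r₁≢r₂ = begin
    ∫ V (λ φ → 𝟙 (lookup φ r₁ ⊕ c₁ Fin.≟ lookup φ r₂ ⊕ c₂)) + P * 0
      ≡⟨ cong (_+ P * 0) (∫-vectors-lines (λ φ → 𝟙 (lookup φ r₁ ⊕ c₁ Fin.≟ lookup φ r₂ ⊕ c₂)) r₂ lines) ⟩
    P + P * 0
      ≡⟨ trans (cong (P +_) (*-zeroʳ P)) (+-identityʳ P) ⟩
    P ∎
    where
    open ≡-Reasoning
    V : Weighting (Vec (Fin (suc k)) (suc k))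
    V = vectors (suc k) (suc k)
    P : ℕ
    P = suc k ^ k
    lines : ∀ φ → ∑[ b < suc k ] 𝟙 (lookup (φ [ r₂ ]≔ b) r₁ ⊕ c₁ Fin.≟ lookup (φ [ r₂ ]≔ b) r₂ ⊕ c₂) ≡ 1
    lines φ = trans (sum-cong-≗ {suc k} λ b → cong₂ (λ y z → 𝟙 (y ⊕ c₁ Fin.≟ z ⊕ c₂))
                                                     (lookup∘update′ r₁≢r₂ φ b) (lookup∘update r₂ φ b))
                    (∑-𝟙≟⊕ (lookup φ r₁ ⊕ c₁) c₂)

  load≤ : ∀ z → ∫ μ (λ x → 𝟙 (isSol? x z)) ≤ suc k ^ k
  load≤ (u , v) with u Fin.≟ v
  ... | yes refl = ≤-trans (≤-reflexive (trans (∫-cong μ λ x → 𝟙-no (isSol? x (u , u)) (Fin.<-irrefl refl ∘ proj₁))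
                                               (∫-0 μ)))
                           z≤n
  ... | no u≢v = begin
    ∫ μ (λ x → 𝟙 (isSol? x (u , v)))   ≤⟨ ∫-mono μ (λ x → 𝟙-mono (isSol? x (u , v)) (x u Fin.≟ x v) proj₂) ⟩
    ∫ μ (λ x → 𝟙 (x u Fin.≟ x v))      ≡⟨ collision-weight _ _ _ _ (u≢v ∘ cell-injective) ⟩
    suc k ^ k                          ∎
    where open ≤-Reasoning

triangular-gap : ∀ {n} → 2 < n → let T = triangular (suc n) in
                 suc (suc n) * suc n + (suc (suc n) + n * (1 * 2)) * T < (1 + 2) * suc (suc n) * T
triangular-gap {n@(suc (suc (suc j)))} (s≤s (s≤s (s≤s z≤n))) = *-cancelˡ-< 2 _ _ (begin-strict
  2 * (α + β * T)             ≡⟨ double-lhs α β T ⟩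
  2 * α + β * (T + T)         ≡⟨ cong (λ x → 2 * α + β * x) (triangular-double n) ⟩
  2 * α + β * (suc n * n)     <⟨ <-by-gap z<s (gap j) ⟩
  γ * (suc n * n)             ≡⟨ cong (γ *_) (triangular-double n) ⟨
  γ * (T + T)                 ≡⟨ double-rhs γ T ⟩
  2 * (γ * T)                 ∎)
  where
  open ≤-Reasoning
  T α β γ : ℕ
  T = triangular (suc n)
  α = suc (suc n) * suc n
  β = suc (suc n) + n * (1 * 2)
  γ = (1 + 2) * suc (suc n)
  double-lhs : ∀ a b t → 2 * (a + b * t) ≡ 2 * a + b * (t + t)
  double-lhs = solve-∀
  double-rhs : ∀ c t → c * (t + t) ≡ 2 * (c * t)
  double-rhs = solve-∀
  gap : ∀ j → let n = 3 + j in
        2 * (suc (suc n) * suc n) + (suc (suc n) + n * (1 * 2)) * (suc n * n) + suc (2 * (j * j) + 10 * j + 7)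
          ≡ (1 + 2) * suc (suc n) * (suc n * n)
  gap = solve-∀

¬PHP[n+1]≤PHP[n+2] : ∀ {n} → 2 < n → ¬ (PHP (n + 1) n ≤ᵖ PHP (n + 2) n)
¬PHP[n+1]≤PHP[n+2] {n} 2<n rewrite +-comm n 1 | +-comm n 2 =
  idP≰PHP 1 (triangular-gap 2<n) ∘ ≤ᵖ-trans (idP-triangular≤PHP n)

¬PHP[2n]≤PHP[2n+1] : ∀ {n} → 1 < n → ¬ (PHP (2 * n) n ≤ᵖ PHP (2 * n + 1) n)
¬PHP[2n]≤PHP[2n+1] {n@(suc (suc j))} (s≤s (s≤s z≤n)) rewrite +-comm (2 * n) 1 =
  idP≰PHP 2 (<-by-gap z<s (gap j)) ∘ ≤ᵖ-trans (idP[2k+1]≤PHP[2k+2] (suc j))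
  where
  gap : ∀ j → let n = 2 + j; m = suc (suc j + suc j) in
        suc (2 * n) * (2 * n) + (suc (2 * n) + n * (2 * 3)) * m + suc (4 * j + 3) ≡ (2 + 3) * suc (2 * n) * m
  gap = solve-∀

affine-gap : ∀ k P → 0 < P → let n = suc k; W = n * P + P * 1 in
             suc (n * n) * (n * n) * P + (suc (n * n) + n * (n * suc n)) * W < (n + suc n) * suc (n * n) * W
affine-gap k P 0<P = <-by-gap (<-≤-trans 0<P (m≤m+n P (P * suc (2 * k)))) (identity k P)
  where
  identity : ∀ k P → let n = suc k; W = n * P + P * 1 in
             suc (n * n) * (n * n) * P + (suc (n * n) + n * (n * suc n)) * W + (P + P * suc (2 * k))
               ≡ (n + suc n) * suc (n * n) * W
  identity = solve-∀

¬PHP[n²]≤PHP[n²+1] : ∀ {n} → 0 < n → ¬ (PHP (n * n) n ≤ᵖ PHP (n * n + 1) n)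
¬PHP[n²]≤PHP[n²+1] {n@(suc k)} _ rewrite +-comm (n * n) 1 = λ R → <⇒≱ (affine-gap k P (m^n>0 n k)) (begin
  (n + suc n) * suc (n * n) * (n * P + P * 1)    ≡⟨ cong ((n + suc n) * suc (n * n) *_) mass-μ ⟨
  (n + suc n) * suc (n * n) * mass μ             ≤⟨ reduction-bound R isSol? μ P load≤ n ⟩
  suc (n * n) * (n * n) * P + β * mass μ         ≡⟨ cong (λ w → suc (n * n) * (n * n) * P + β * w) mass-μ ⟩
  suc (n * n) * (n * n) * P + β * (n * P + P * 1) ∎)
  where
  open Affine k
  open ≤-Reasoning
  P β : ℕ
  P = n ^ k
  β = suc (n * n) + n * (n * suc n)

n+2≤2*n : ∀ {n} → 1 < n → n + 2 ≤ 2 * n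
n+2≤2*n {suc (suc j)} (s≤s (s≤s z≤n)) = ≤-by-gap j (identity j)
  where
  identity : ∀ j → 2 + j + 2 + j ≡ 2 * (2 + j)
  identity = solve-∀

2*n+1≤n*n : ∀ {n} → 2 < n → 2 * n + 1 ≤ n * n
2*n+1≤n*n {suc (suc (suc j))} (s≤s (s≤s (s≤s z≤n))) = ≤-by-gap (j * j + 4 * j + 2) (identity j)
  where
  identity : ∀ j → 2 * (3 + j) + 1 + (j * j + 4 * j + 2) ≡ (3 + j) * (3 + j)
  identity = solve-∀

theorem2p20 :
    (idP 3 ≡ᵖ PHP 3 2) × (PHP 3 2 ≡ᵖ PHP 4 2) × (PHP 4 2 >ᵖ PHP 5 2)
    × (∀ (n : ℕ) → 2 < n →
         (idP ((n + 1) C 2) ≡ᵖ PHP (n + 1) n)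
         × (PHP (n + 1) n >ᵖ PHP (n + 2) n)
         × (PHP (n + 2) n ≥ᵖ PHP (2 * n) n)
         × (PHP (2 * n) n >ᵖ PHP (2 * n + 1) n)
         × (PHP (2 * n + 1) n ≥ᵖ PHP (n * n) n)
         × (PHP (n * n) n >ᵖ PHP (n * n + 1) n))
theorem2p20 =
  (idP-triangular≤PHP 2 , PHP≤idP-triangular 2) ,
  (≤ᵖ-trans (PHP≤idP-triangular 2) (idP[2k+1]≤PHP[2k+2] 1) , PHP-antimonoˡ (n≤1+n 3)) ,
  (PHP-antimonoˡ (n≤1+n 4) , ¬PHP[2n]≤PHP[2n+1] {2} (s≤s (s≤s z≤n))) ,
  λ n 2<n →
    idP[C[n+1,2]]≡PHP[n+1] n ,
    (PHP-antimonoˡ (+-monoʳ-≤ n (n≤1+n 1)) , ¬PHP[n+1]≤PHP[n+2] 2<n) ,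
    PHP-antimonoˡ (n+2≤2*n (<⇒≤ 2<n)) ,
    (PHP-antimonoˡ (m≤m+n (2 * n) 1) , ¬PHP[2n]≤PHP[2n+1] (<⇒≤ 2<n)) ,
    PHP-antimonoˡ (2*n+1≤n*n 2<n) ,
    (PHP-antimonoˡ (m≤m+n (n * n) 1) , ¬PHP[n²]≤PHP[n²+1] (<-trans z<s 2<n))
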